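{- Let $P=\mathrm{conv}\{x\in\{0,1\}^4 : x_1+x_2+x_3+x_4=2\}$. Then there is no graph $G$ such that $P\le_A\mathrm{SSP}(G)$.
   Context: For a graph $G=(V,E)$ with $V=\{v_1,\dots,v_k\}$, the stable set polytope $\mathrm{SSP}(G)$ is the convex hull of $\{y\in\{0,1\}^k : y_i+y_j\le 1 \text{ for every edge }\{v_i,v_j\}\in E\}$. For polytopes $p,q$, $p\le_A q$ means that $p$ is affinely equivalent (there is an affine bijection between their affine hulls mapping one onto the other) to $q$ or to a face of $q$.
   Formalization: Points have rational coordinates, and the convex hulls, the inequalities defining faces and the affine bijections in $\le_A$ are taken over ℚ instead of ℝ. -}

module Defs where

open import Data.Nat using (ℕ; zero; suc)
open import Data.Fin using (Fin; zero; suc)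
open import Data.Rational using (ℚ; 0ℚ; 1ℚ; _+_; _*_; _≤_)
open import Data.Product using (Σ; _×_)
open import Data.Sum using (_⊎_)
open import Relation.Binary.PropositionalEquality using (_≡_)
open import Relation.Nullary using (¬_)

Point : ℕ → Set
Point k = Fin k → ℚ

PSet : ℕ → Set₁
PSet k = Point k → Set

_≋_ : ∀ {k} → Point k → Point k → Set
x ≋ y = ∀ j → x j ≡ y j

sumF : ∀ {m} → (Fin m → ℚ) → ℚ
sumF {zero} f = 0ℚ
sumF {suc m} f = f zero + sumF (λ i → f (suc i))

comb : ∀ {m k} → (Fin m → Point k) → (Fin m → ℚ) → Point k
comb v w j = sumF (λ i → w i * v i j)

dot : ∀ {k} → Point k → Point k → ℚ
dot c x = sumF (λ i → c i * x i)

Conv : ∀ {k} → PSet k → PSet k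
Conv {k} S x = Σ ℕ λ m → Σ (Fin m → Point k) λ v → Σ (Fin m → ℚ) λ w →
  (∀ i → S (v i)) × (∀ i → 0ℚ ≤ w i) × (sumF w ≡ 1ℚ) × (x ≋ comb v w)

Aff : ∀ {k} → PSet k → PSet k
Aff {k} S x = Σ ℕ λ m → Σ (Fin m → Point k) λ v → Σ (Fin m → ℚ) λ w →
  (∀ i → S (v i)) × (sumF w ≡ 1ℚ) × (x ≋ comb v w)

IsBin : ℚ → Set
IsBin q = (q ≡ 0ℚ) ⊎ (q ≡ 1ℚ)

HypVert : PSet 4
HypVert x = (∀ i → IsBin (x i)) × (sumF x ≡ 1ℚ + 1ℚ)

P : PSet 4
P = Conv HypVert

record Graph (k : ℕ) : Set₁ where
  field
    Adj   : Fin k → Fin k → Set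
    sym   : ∀ i j → Adj i j → Adj j i
    irrefl : ∀ i → ¬ Adj i i

StableVec : ∀ {k} → Graph k → PSet k
StableVec G y = (∀ i → IsBin (y i)) × (∀ i j → Graph.Adj G i j → y i + y j ≤ 1ℚ)

SSP : ∀ {k} → Graph k → PSet k
SSP G = Conv (StableVec G)

-- faces: Q ∩ {c·x = δ} for a valid inequality c·x ≤ δ (includes Q and ∅)
ValidIneq : ∀ {k} → PSet k → Point k → ℚ → Set
ValidIneq Q c δ = ∀ x → Q x → dot c x ≤ δ

Face : ∀ {k} → PSet k → Point k → ℚ → PSet k
Face Q c δ x = Q x × (dot c x ≡ δ)

affApp : ∀ {n k} → (Fin k → Fin n → ℚ) → Point k → Point n → Point k
affApp A b x j = b j + sumF (λ i → A j i * x i)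

AffEquiv : ∀ {n k} → PSet n → PSet k → Set
AffEquiv {n} {k} p q = Σ (Fin k → Fin n → ℚ) λ A → Σ (Point k) λ b →
  (∀ x → Aff p x → Aff q (affApp A b x)) ×
  (∀ x y → Aff p x → Aff p y → affApp A b x ≋ affApp A b y → x ≋ y) ×
  (∀ y → Aff q y → Σ (Point n) λ x → Aff p x × (affApp A b x ≋ y)) ×
  (∀ x → p x → q (affApp A b x)) ×
  (∀ y → q y → Σ (Point n) λ x → p x × (affApp A b x ≋ y))

_≤A_ : ∀ {n k} → PSet n → PSet k → Set
_≤A_ {n} {k} p q = Σ (Point k) λ c → Σ ℚ λ δ →
  ValidIneq q c δ × AffEquiv p (Face q c δ)

-- Let f be the affine bijection from P onto a face F = {c·x = δ} of SSP(G), and y σ = f (e_i + e_j)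
-- for the six vertices σ = {i,j} of P. The y σ are stable 0/1 vectors with
-- y₁₂ + y₃₄ = y₁₃ + y₂₄ = y₁₄ + y₂₃. Coordinatewise this forces the set of σ with (y σ)_j = 1 to be
-- empty, everything, a star (the pairs through some i) or a co-star (the pairs avoiding i).
-- Let z and z̄ indicate the coordinates whose set is full or a star, resp. full or a co-star. Stars
-- pairwise intersect, and so do co-stars, hence z and z̄ are stable; since z + z̄ = y₁₂ + y₃₄, both
-- attain δ and z lies in F. Being a 0/1 point of F, z = y σ for some σ, and then f identifies the two
-- other pairs through one end of σ, contradicting injectivity.

module Submission where

open import Data.Bool using (Bool; true; false; _∧_; _∨_; not)
open import Data.Bool.Properties using () renaming (_≟_ to _≟ᵇ_)
open import Data.Empty using (⊥-elim)
open import Data.Fin using (Fin; zero; suc) renaming (_≟_ to _≟ᶠ_)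
open import Data.Fin.Patterns using (0F; 1F; 2F; 3F)
open import Data.Fin.Properties using (all?; any?)
open import Data.Nat using (ℕ; zero; suc)
open import Data.Product using (Σ; ∃; _×_; _,_; proj₁; proj₂)
open import Data.Rational using (ℚ; 0ℚ; 1ℚ; _+_; _*_; _-_; -_; _≤_; _<_; positive; nonNegative)
open import Data.Rational.Properties
open import Data.Rational.Solver using (module +-*-Solver)
open import Algebra.Properties.Group +-0-group using (x∙y⁻¹≈ε⇒x≈y)
open import Data.Sum using (inj₁; inj₂)
open import Relation.Binary.PropositionalEquality
open import Relation.Nullary using (¬_; Dec; yes; no; ¬?)
open import Relation.Nullary.Decidable using (does; from-yes; map′; _×-dec_; _⊎-dec_; _→-dec_)

open import Defs

open +-*-Solver

-- Finite sums and averages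

sumF-cong : ∀ {m} {f g : Fin m → ℚ} → (∀ i → f i ≡ g i) → sumF f ≡ sumF g
sumF-cong {zero}  f≡g = refl
sumF-cong {suc m} f≡g = cong₂ _+_ (f≡g zero) (sumF-cong (λ i → f≡g (suc i)))

sumF-0 : ∀ {m} → sumF {m} (λ _ → 0ℚ) ≡ 0ℚ
sumF-0 {zero}  = refl
sumF-0 {suc m} = cong (0ℚ +_) (sumF-0 {m})

sumF-+ : ∀ {m} (f g : Fin m → ℚ) → sumF (λ i → f i + g i) ≡ sumF f + sumF g
sumF-+ {zero}  f g = refl
sumF-+ {suc m} f g =
  trans (cong (f zero + g zero +_) (sumF-+ (λ i → f (suc i)) (λ i → g (suc i))))
        (interchange (f zero) (g zero) _ _)
  where
  interchange : ∀ a b c d → (a + b) + (c + d) ≡ (a + c) + (b + d)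
  interchange = solve 4 (λ a b c d → (a :+ b) :+ (c :+ d) := (a :+ c) :+ (b :+ d)) refl

sumF-*ˡ : ∀ {m} r (f : Fin m → ℚ) → sumF (λ i → r * f i) ≡ r * sumF f
sumF-*ˡ {zero}  r f = sym (*-zeroʳ r)
sumF-*ˡ {suc m} r f =
  trans (cong (r * f zero +_) (sumF-*ˡ r (λ i → f (suc i))))
        (sym (*-distribˡ-+ r (f zero) _))

sumF-neg : ∀ {m} (f : Fin m → ℚ) → sumF (λ i → - f i) ≡ - sumF f
sumF-neg {zero}  f = refl
sumF-neg {suc m} f =
  trans (cong (- f zero +_) (sumF-neg (λ i → f (suc i))))
        (sym (neg-distrib-+ (f zero) _))

sumF-swap : ∀ {m n} (g : Fin m → Fin n → ℚ) →
            sumF (λ i → sumF (g i)) ≡ sumF (λ j → sumF (λ i → g i j))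
sumF-swap {zero}  {n} g = sym (sumF-0 {n})
sumF-swap {suc m} {n} g =
  trans (cong (sumF (g zero) +_) (sumF-swap (λ i → g (suc i))))
        (sym (sumF-+ (g zero) _))

sumF-mono-≤ : ∀ {m} {f g : Fin m → ℚ} → (∀ i → f i ≤ g i) → sumF f ≤ sumF g
sumF-mono-≤ {zero}  f≤g = ≤-refl
sumF-mono-≤ {suc m} f≤g = +-mono-≤ (f≤g zero) (sumF-mono-≤ (λ i → f≤g (suc i)))

sumF-nonNeg : ∀ {m} {f : Fin m → ℚ} → (∀ i → 0ℚ ≤ f i) → 0ℚ ≤ sumF f
sumF-nonNeg {m} {f} 0≤f = subst (_≤ sumF f) (sumF-0 {m}) (sumF-mono-≤ 0≤f)

sumF-nonNeg≡0⇒≡0 : ∀ {m} {f : Fin m → ℚ} → (∀ i → 0ℚ ≤ f i) → sumF f ≡ 0ℚ → ∀ i → f i ≡ 0ℚ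
sumF-nonNeg≡0⇒≡0 {suc m} {f} 0≤f Σf≡0 i = case i
  where
  rest = sumF (λ i → f (suc i))
  0≤rest : 0ℚ ≤ rest
  0≤rest = sumF-nonNeg (λ i → 0≤f (suc i))
  head≡0 : f zero ≡ 0ℚ
  head≡0 = ≤-antisym (subst₂ _≤_ (+-identityʳ (f zero)) Σf≡0 (+-monoʳ-≤ (f zero) 0≤rest)) (0≤f zero)
  rest≡0 : rest ≡ 0ℚ
  rest≡0 = trans (sym (+-identityˡ rest)) (trans (cong (_+ rest) (sym head≡0)) Σf≡0)
  case : ∀ i → f i ≡ 0ℚ
  case zero    = head≡0
  case (suc i) = sumF-nonNeg≡0⇒≡0 (λ i → 0≤f (suc i)) rest≡0 i

sumF≢0⇒∃positive : ∀ {m} (f : Fin m → ℚ) → (∀ i → 0ℚ ≤ f i) → sumF f ≢ 0ℚ → ∃ λ i → 0ℚ < f i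
sumF≢0⇒∃positive {zero}  f 0≤f Σf≢0 = ⊥-elim (Σf≢0 refl)
sumF≢0⇒∃positive {suc m} f 0≤f Σf≢0 with 0ℚ <? f zero
... | yes 0<f₀ = zero , 0<f₀
... | no  0≮f₀ = let (i , 0<fᵢ) = sumF≢0⇒∃positive (λ i → f (suc i)) (λ i → 0≤f (suc i)) rest≢0 in suc i , 0<fᵢ
  where
  rest≢0 : sumF (λ i → f (suc i)) ≢ 0ℚ
  rest≢0 rest≡0 = Σf≢0 (cong₂ _+_ (≤-antisym (≮⇒≥ 0≮f₀) (0≤f zero)) rest≡0)

sumF≡1⇒∃positive : ∀ {m} (f : Fin m → ℚ) → (∀ i → 0ℚ ≤ f i) → sumF f ≡ 1ℚ → ∃ λ i → 0ℚ < f i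
sumF≡1⇒∃positive f 0≤f Σf≡1 = sumF≢0⇒∃positive f 0≤f (λ Σf≡0 → 1≢0 (trans (sym Σf≡1) Σf≡0))

pos*≡0⇒≡0 : ∀ {w h} → 0ℚ < w → w * h ≡ 0ℚ → h ≡ 0ℚ
pos*≡0⇒≡0 {w} {h} 0<w wh≡0 =
  ≤-antisym (*-cancelˡ-≤-pos w (≤-reflexive (trans wh≡0 (sym (*-zeroʳ w)))))
            (*-cancelˡ-≤-pos w (≤-reflexive (trans (*-zeroʳ w) (sym wh≡0))))
  where instance _ = positive 0<w

nonNeg*nonNeg : ∀ {p q} → 0ℚ ≤ p → 0ℚ ≤ q → 0ℚ ≤ p * q
nonNeg*nonNeg {p} {q} 0≤p 0≤q =
  nonNegative⁻¹ (p * q) {{nonNeg*nonNeg⇒nonNeg p {{nonNegative 0≤p}} q {{nonNegative 0≤q}}}}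

p≤q⇒0≤q-p : ∀ {p q} → p ≤ q → 0ℚ ≤ q - p
p≤q⇒0≤q-p {p} {q} p≤q = subst (_≤ q - p) (+-inverseʳ p) (+-monoˡ-≤ (- p) p≤q)

bounded-sum≡⇒≡ : ∀ {p q r} → p ≤ r → q ≤ r → p + q ≡ r + r → p ≡ r
bounded-sum≡⇒≡ {p} {q} {r} p≤r q≤r p+q≡r+r =
  ≤-antisym p≤r (subst₂ _≤_ (cancel r r) (cancel p r) (+-monoˡ-≤ (- r) r+r≤p+r))
  where
  r+r≤p+r : r + r ≤ p + r
  r+r≤p+r = subst (_≤ p + r) p+q≡r+r (+-monoʳ-≤ p q≤r)
  cancel : ∀ a b → (a + b) - b ≡ a
  cancel = solve 2 (λ a b → (a :+ b) :- b := a) refl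

dot-cong : ∀ {k} (c : Point k) {x y : Point k} → x ≋ y → dot c x ≡ dot c y
dot-cong c x≋y = sumF-cong (λ i → cong (c i *_) (x≋y i))

dot-+ : ∀ {k} (c x y : Point k) → dot c (λ i → x i + y i) ≡ dot c x + dot c y
dot-+ c x y = trans (sumF-cong (λ i → *-distribˡ-+ (c i) (x i) (y i))) (sumF-+ (λ i → c i * x i) (λ i → c i * y i))

dot-const-minus : ∀ {m} (w g : Fin m → ℚ) r → dot w (λ t → r - g t) ≡ r * sumF w - dot w g
dot-const-minus w g r = begin
  sumF (λ t → w t * (r - g t))                      ≡⟨ sumF-cong (λ t → expand (w t) (g t) r) ⟩
  sumF (λ t → r * w t + - (w t * g t))              ≡⟨ sumF-+ (λ t → r * w t) (λ t → - (w t * g t)) ⟩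
  sumF (λ t → r * w t) + sumF (λ t → - (w t * g t)) ≡⟨ cong₂ _+_ (sumF-*ˡ r w) (sumF-neg (λ t → w t * g t)) ⟩
  r * sumF w - dot w g                              ∎
  where
  open ≡-Reasoning
  expand : ∀ a b r → a * (r - b) ≡ r * a + - (a * b)
  expand = solve 3 (λ a b r → a :* (r :- b) := r :* a :+ :- (a :* b)) refl

nonNeg-average≡0 : ∀ {m} {w g : Fin m → ℚ} → (∀ t → 0ℚ ≤ w t) → (∀ t → 0ℚ ≤ g t) →
                   dot w g ≡ 0ℚ → ∀ t → 0ℚ < w t → g t ≡ 0ℚ
nonNeg-average≡0 0≤w 0≤g w·g≡0 t 0<wₜ =
  pos*≡0⇒≡0 0<wₜ (sumF-nonNeg≡0⇒≡0 (λ t → nonNeg*nonNeg (0≤w t) (0≤g t)) w·g≡0 t)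

average≡upperBound : ∀ {m} {w g : Fin m → ℚ} {r} → (∀ t → 0ℚ ≤ w t) → sumF w ≡ 1ℚ →
                     (∀ t → g t ≤ r) → dot w g ≡ r → ∀ t → 0ℚ < w t → g t ≡ r
average≡upperBound {w = w} {g} {r} 0≤w Σw≡1 g≤r w·g≡r t 0<wₜ =
  sym (x∙y⁻¹≈ε⇒x≈y r (g t) (nonNeg-average≡0 0≤w (λ t → p≤q⇒0≤q-p (g≤r t)) slack≡0 t 0<wₜ))
  where
  slack≡0 : dot w (λ t → r - g t) ≡ 0ℚ
  slack≡0 = begin
    dot w (λ t → r - g t) ≡⟨ dot-const-minus w g r ⟩
    r * sumF w - dot w g  ≡⟨ cong₂ (λ a b → r * a - b) Σw≡1 w·g≡r ⟩
    r * 1ℚ - r            ≡⟨ cong (_- r) (*-identityʳ r) ⟩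
    r - r                 ≡⟨ +-inverseʳ r ⟩
    0ℚ                    ∎
    where open ≡-Reasoning

dot-comb : ∀ {m k} (c : Point k) (v : Fin m → Point k) (w : Fin m → ℚ) →
           dot c (comb v w) ≡ dot w (λ t → dot c (v t))
dot-comb c v w = begin
  sumF (λ i → c i * sumF (λ t → w t * v t i))   ≡⟨ sumF-cong (λ i → sym (sumF-*ˡ (c i) (λ t → w t * v t i))) ⟩
  sumF (λ i → sumF (λ t → c i * (w t * v t i))) ≡⟨ sumF-swap (λ i t → c i * (w t * v t i)) ⟩
  sumF (λ t → sumF (λ i → c i * (w t * v t i))) ≡⟨ sumF-cong (λ t → trans (sumF-cong (λ i → rearrange (c i) (w t) (v t i)))
                                                                         (sumF-*ˡ (w t) (λ i → c i * v t i))) ⟩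
  sumF (λ t → w t * dot c (v t))                ∎
  where
  open ≡-Reasoning
  rearrange : ∀ a b x → a * (b * x) ≡ b * (a * x)
  rearrange = solve 3 (λ a b x → a :* (b :* x) := b :* (a :* x)) refl

affApp-cong : ∀ {n k} (A : Fin k → Fin n → ℚ) (b : Point k) {x y : Point n} →
              x ≋ y → affApp A b x ≋ affApp A b y
affApp-cong A b x≋y j = cong (b j +_) (dot-cong (A j) x≋y)

affApp-comb : ∀ {m n k} (A : Fin k → Fin n → ℚ) (b : Point k) (v : Fin m → Point n) (w : Fin m → ℚ) →
              sumF w ≡ 1ℚ → affApp A b (comb v w) ≋ comb (λ t → affApp A b (v t)) w
affApp-comb A b v w Σw≡1 j = sym (begin
  sumF (λ t → w t * (b j + dot (A j) (v t)))                  ≡⟨ sumF-cong (λ t → *-distribˡ-+ (w t) (b j) _) ⟩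
  sumF (λ t → w t * b j + w t * dot (A j) (v t))              ≡⟨ sumF-+ (λ t → w t * b j) (λ t → w t * dot (A j) (v t)) ⟩
  sumF (λ t → w t * b j) + sumF (λ t → w t * dot (A j) (v t)) ≡⟨ cong₂ _+_ Σwb≡b (sym (dot-comb (A j) v w)) ⟩
  b j + dot (A j) (comb v w)                                  ∎)
  where
  open ≡-Reasoning
  Σwb≡b : sumF (λ t → w t * b j) ≡ b j
  Σwb≡b = begin
    sumF (λ t → w t * b j) ≡⟨ sumF-cong (λ t → *-comm (w t) (b j)) ⟩
    sumF (λ t → b j * w t) ≡⟨ sumF-*ˡ (b j) w ⟩
    b j * sumF w           ≡⟨ cong (b j *_) Σw≡1 ⟩
    b j * 1ℚ               ≡⟨ *-identityʳ (b j) ⟩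
    b j                    ∎

affApp-parallelogram : ∀ {n k} (A : Fin k → Fin n → ℚ) (b : Point k) {x x′ u u′ : Point n} →
                       (∀ i → x i + x′ i ≡ u i + u′ i) →
                       ∀ j → affApp A b x j + affApp A b x′ j ≡ affApp A b u j + affApp A b u′ j
affApp-parallelogram A b {x} {x′} {u} {u′} x+x′≡u+u′ j = begin
  (b j + dot a x) + (b j + dot a x′) ≡⟨ regroup (b j) (dot a x) (dot a x′) ⟩
  (b j + b j) + (dot a x + dot a x′) ≡⟨ cong ((b j + b j) +_) (sym (dot-+ a x x′)) ⟩
  (b j + b j) + dot a (λ i → x i + x′ i) ≡⟨ cong ((b j + b j) +_) (dot-cong a x+x′≡u+u′) ⟩
  (b j + b j) + dot a (λ i → u i + u′ i) ≡⟨ cong ((b j + b j) +_) (dot-+ a u u′) ⟩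
  (b j + b j) + (dot a u + dot a u′) ≡⟨ sym (regroup (b j) (dot a u) (dot a u′)) ⟩
  (b j + dot a u) + (b j + dot a u′) ∎
  where
  open ≡-Reasoning
  a = A j
  regroup : ∀ β p q → (β + p) + (β + q) ≡ (β + β) + (p + q)
  regroup = solve 3 (λ β p q → (β :+ p) :+ (β :+ q) := (β :+ β) :+ (p :+ q)) refl

-- Convex hulls of 0/1 points

Binary : ∀ {k} → Point k → Set
Binary x = ∀ j → IsBin (x j)

InCube : ∀ {k} → Point k → Set
InCube x = ∀ j → 0ℚ ≤ x j × x j ≤ 1ℚ

0≤1 : 0ℚ ≤ 1ℚ
0≤1 = ≤ᵇ⇒≤ _

Binary⇒InCube : ∀ {k} {x : Point k} → Binary x → InCube x
Binary⇒InCube {x = x} x∈01 j with x∈01 j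
... | inj₁ xⱼ≡0 = subst (λ q → 0ℚ ≤ q × q ≤ 1ℚ) (sym xⱼ≡0) (≤-refl , 0≤1)
... | inj₂ xⱼ≡1 = subst (λ q → 0ℚ ≤ q × q ≤ 1ℚ) (sym xⱼ≡1) (0≤1 , ≤-refl)

Conv-singleton : ∀ {k} {S : PSet k} {x} → S x → Conv S x
Conv-singleton {x = x} Sx = 1 , (λ _ → x) , (λ _ → 1ℚ) , (λ _ → Sx) , (λ _ → 0≤1) , refl ,
                            λ j → sym (trans (+-identityʳ (1ℚ * x j)) (*-identityˡ (x j)))

Conv⇒Aff : ∀ {k} {S : PSet k} {x} → Conv S x → Aff S x
Conv⇒Aff (m , v , w , Sv , _ , Σw≡1 , x≋) = m , v , w , Sv , Σw≡1 , x≋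

Conv-InCube : ∀ {k} {S : PSet k} → (∀ s → S s → InCube s) → ∀ {x} → Conv S x → InCube x
Conv-InCube S⊆cube (m , v , w , Sv , 0≤w , Σw≡1 , x≋) j =
  subst (0ℚ ≤_) (sym (x≋ j)) (sumF-nonNeg (λ t → nonNeg*nonNeg (0≤w t) (proj₁ (cube t)))) ,
  subst (_≤ 1ℚ) (sym (x≋ j)) (subst (comb v w j ≤_) Σw≡1 (sumF-mono-≤ (λ t → w*vₜ≤w t)))
  where
  cube : ∀ t → 0ℚ ≤ v t j × v t j ≤ 1ℚ
  cube t = S⊆cube (v t) (Sv t) j
  w*vₜ≤w : ∀ t → w t * v t j ≤ w t
  w*vₜ≤w t = subst (w t * v t j ≤_) (*-identityʳ (w t))
                   (*-monoˡ-≤-nonNeg (w t) {{nonNegative (0≤w t)}} (proj₂ (cube t)))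

-- A 0/1 point is a vertex of the unit cube.
binary-combination : ∀ {m k} {x : Fin m → Point k} {w : Fin m → ℚ} {v : Point k} →
                     Binary v → (∀ t → InCube (x t)) → (∀ t → 0ℚ ≤ w t) → sumF w ≡ 1ℚ →
                     v ≋ comb x w → ∃ λ t → x t ≋ v
binary-combination {x = x} {w} {v} v∈01 x∈cube 0≤w Σw≡1 v≋ = t₀ , xₜ₀≋v
  where
  t₀,0<w = sumF≡1⇒∃positive w 0≤w Σw≡1
  t₀ = proj₁ t₀,0<w
  xₜ₀≋v : x t₀ ≋ v
  xₜ₀≋v j with v∈01 j
  ... | inj₁ vⱼ≡0 = trans (nonNeg-average≡0 0≤w (λ t → proj₁ (x∈cube t j)) (trans (sym (v≋ j)) vⱼ≡0) t₀ (proj₂ t₀,0<w))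
                          (sym vⱼ≡0)
  ... | inj₂ vⱼ≡1 = trans (average≡upperBound 0≤w Σw≡1 (λ t → proj₂ (x∈cube t j)) (trans (sym (v≋ j)) vⱼ≡1) t₀ (proj₂ t₀,0<w))
                          (sym vⱼ≡1)

Face-Conv⊆Conv-Face : ∀ {k} {S : PSet k} {c δ} → ValidIneq (Conv S) c δ →
                      ∀ {y} → Face (Conv S) c δ y → Conv (Face S c δ) y
Face-Conv⊆Conv-Face {S = S} {c} {δ} valid ((m , s , w , Ss , 0≤w , Σw≡1 , y≋) , c·y≡δ) =
  m , s′ , w , s′∈Face , 0≤w , Σw≡1 , λ j → trans (y≋ j) (sumF-cong (λ t → same-term j t))
  where
  tight : ∀ t → 0ℚ < w t → dot c (s t) ≡ δ
  tight = average≡upperBound 0≤w Σw≡1 (λ t → valid (s t) (Conv-singleton {S = S} (Ss t)))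
                             (trans (sym (dot-comb c s w)) (trans (sym (dot-cong c y≋)) c·y≡δ))
  t₀,0<w = sumF≡1⇒∃positive w 0≤w Σw≡1
  t₀ = proj₁ t₀,0<w
  -- generators of weight 0 need not lie in the face; replace them by one that does
  s′ : Fin m → Point _
  s′ t with 0ℚ <? w t
  ... | yes _ = s t
  ... | no  _ = s t₀
  s′∈Face : ∀ t → Face S c δ (s′ t)
  s′∈Face t with 0ℚ <? w t
  ... | yes 0<wₜ = Ss t , tight t 0<wₜ
  ... | no  _    = Ss t₀ , tight t₀ (proj₂ t₀,0<w)
  same-term : ∀ j t → w t * s t j ≡ w t * s′ t j
  same-term j t with 0ℚ <? w t
  ... | yes _   = refl
  ... | no 0≮wₜ = let wₜ≡0 = ≤-antisym (≮⇒≥ 0≮wₜ) (0≤w t) in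
                  trans (cong (_* s t j) wₜ≡0) (trans (*-zeroˡ (s t j))
                        (sym (trans (cong (_* s t₀ j) wₜ≡0) (*-zeroˡ (s t₀ j)))))

module AffineEquivalence
  {n k} {V : PSet n} {W : PSet k} {c : Point k} {δ : ℚ}
  (V-binary : ∀ v → V v → Binary v) (W-binary : ∀ w → W w → Binary w)
  (valid : ValidIneq (Conv W) c δ) (A : Fin k → Fin n → ℚ) (b : Point k)
  (injective : ∀ x y → Aff (Conv V) x → Aff (Conv V) y → affApp A b x ≋ affApp A b y → x ≋ y)
  (into : ∀ x → Conv V x → Face (Conv W) c δ (affApp A b x))
  (onto : ∀ y → Face (Conv W) c δ y → Σ (Point n) λ x → Conv V x × affApp A b x ≋ y)
  where

  f : Point n → Point k
  f = affApp A b

  Conv-W-InCube : ∀ {y} → Conv W y → InCube y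
  Conv-W-InCube = Conv-InCube (λ s Ws → Binary⇒InCube (W-binary s Ws))

  Conv-V-InCube : ∀ {x} → Conv V x → InCube x
  Conv-V-InCube = Conv-InCube (λ s Vs → Binary⇒InCube (V-binary s Vs))

  -- Pulling the face generators of f v back along f, injectivity on aff P writes the 0/1 point v
  -- as a convex combination of points of P, so v is one of them.
  generator-image : ∀ {v} → V v → ∃ λ s → W s × s ≋ f v
  generator-image {v} Vv with Face-Conv⊆Conv-Face {S = W} {c} {δ} valid (into v (Conv-singleton {S = V} Vv))
  ... | m , s , w , s∈Face , 0≤w , Σw≡1 , fv≋ =
    s t₀ , proj₁ (s∈Face t₀) , λ j → trans (sym (proj₂ (proj₂ (pre t₀)) j)) (affApp-cong A b xₜ₀≋v j)
    where
    pre : ∀ t → Σ (Point n) λ x → Conv V x × f x ≋ s t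
    pre t = onto (s t) (Conv-singleton {S = W} (proj₁ (s∈Face t)) , proj₂ (s∈Face t))
    x : Fin m → Point n
    x t = proj₁ (pre t)
    f-comb≋f-v : f (comb x w) ≋ f v
    f-comb≋f-v j = trans (affApp-comb A b x w Σw≡1 j)
                         (trans (sumF-cong (λ t → cong (w t *_) (proj₂ (proj₂ (pre t)) j))) (sym (fv≋ j)))
    comb≋v : comb x w ≋ v
    comb≋v = injective (comb x w) v (m , x , w , (λ t → proj₁ (proj₂ (pre t))) , Σw≡1 , λ _ → refl)
                       (Conv⇒Aff {S = Conv V} (Conv-singleton (Conv-singleton {S = V} Vv))) f-comb≋f-v
    t₀,xₜ₀≋v = binary-combination (V-binary v Vv) (λ t → Conv-V-InCube (proj₁ (proj₂ (pre t))))
                                  0≤w Σw≡1 (λ j → sym (comb≋v j))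
    t₀ = proj₁ t₀,xₜ₀≋v
    xₜ₀≋v = proj₂ t₀,xₜ₀≋v

  binary-preimage : ∀ {z} → Binary z → Face (Conv W) c δ z → ∃ λ v → V v × f v ≋ z
  binary-preimage {z} z∈01 z∈Face with onto z z∈Face
  ... | x , (m , u , w , Vu , 0≤w , Σw≡1 , x≋) , fx≋z = u t₀ , Vu t₀ , fuₜ₀≋z
    where
    z≋ : z ≋ comb (λ t → f (u t)) w
    z≋ j = trans (sym (fx≋z j)) (trans (affApp-cong A b x≋ j) (affApp-comb A b u w Σw≡1 j))
    t₀,fuₜ₀≋z = binary-combination z∈01 (λ t → Conv-W-InCube (proj₁ (into (u t) (Conv-singleton {S = V} (Vu t)))))
                                   0≤w Σw≡1 z≋
    t₀ = proj₁ t₀,fuₜ₀≋z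
    fuₜ₀≋z = proj₂ t₀,fuₜ₀≋z

-- The octahedron P and the supports of its images

fromBit : Bool → ℚ
fromBit false = 0ℚ
fromBit true  = 1ℚ

fromBit-binary : ∀ a → IsBin (fromBit a)
fromBit-binary false = inj₁ refl
fromBit-binary true  = inj₂ refl

IsBin⇒fromBit : ∀ {q} → IsBin q → ∃ λ a → q ≡ fromBit a
IsBin⇒fromBit (inj₁ q≡0) = false , q≡0
IsBin⇒fromBit (inj₂ q≡1) = true , q≡1

fromBit-injective : ∀ a b → fromBit a ≡ fromBit b → a ≡ b
fromBit-injective false false _ = refl
fromBit-injective true  true  _ = refl
fromBit-injective false true  ()
fromBit-injective true  false ()

fromBit-+≤1⇒disjoint : ∀ a b → fromBit a + fromBit b ≤ 1ℚ → (a ∧ b) ≡ false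
fromBit-+≤1⇒disjoint true  true  2≤1 with ≤⇒≤ᵇ 2≤1
... | ()
fromBit-+≤1⇒disjoint true  false _ = refl
fromBit-+≤1⇒disjoint false _     _ = refl

disjoint⇒fromBit-+≤1 : ∀ a b → (a ∧ b) ≡ false → fromBit a + fromBit b ≤ 1ℚ
disjoint⇒fromBit-+≤1 true  true  ()
disjoint⇒fromBit-+≤1 true  false _ = ≤ᵇ⇒≤ _
disjoint⇒fromBit-+≤1 false true  _ = ≤ᵇ⇒≤ _
disjoint⇒fromBit-+≤1 false false _ = ≤ᵇ⇒≤ _

∀-Bool? : {P : Bool → Set} → (∀ a → Dec (P a)) → Dec (∀ a → P a)
∀-Bool? P? = map′ (λ { (Pf , Pt) false → Pf ; (Pf , Pt) true → Pt }) (λ ∀P → ∀P false , ∀P true)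
                  (P? false ×-dec P? true)

-- The vertex e_i + e_j of P is indexed by p_ij, with 1-based i and j (Fin 4 counts from 0).
data Pair : Set where
  p12 p34 p13 p24 p14 p23 : Pair

ends : Pair → Fin 4 × Fin 4
ends p12 = 0F , 1F
ends p34 = 2F , 3F
ends p13 = 0F , 2F
ends p24 = 1F , 3F
ends p14 = 0F , 3F
ends p23 = 1F , 2F

_∈ₚ_ : Fin 4 → Pair → Bool
i ∈ₚ σ = does (i ≟ᶠ proj₁ (ends σ)) ∨ does (i ≟ᶠ proj₂ (ends σ))

vertex : Pair → Point 4
vertex σ i = fromBit (i ∈ₚ σ)

siblings : Pair → Pair × Pair
siblings p12 = p13 , p14
siblings p34 = p13 , p23
siblings p13 = p12 , p14
siblings p24 = p12 , p23
siblings p14 = p12 , p13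
siblings p23 = p12 , p24

∀-Pair? : {P : Pair → Set} → (∀ σ → Dec (P σ)) → Dec (∀ σ → P σ)
∀-Pair? P? = map′
  (λ { (P₁₂ , P₃₄ , P₁₃ , P₂₄ , P₁₄ , P₂₃) → λ { p12 → P₁₂ ; p34 → P₃₄ ; p13 → P₁₃ ; p24 → P₂₄ ; p14 → P₁₄ ; p23 → P₂₃ } })
  (λ ∀P → ∀P p12 , ∀P p34 , ∀P p13 , ∀P p24 , ∀P p14 , ∀P p23)
  (P? p12 ×-dec P? p34 ×-dec P? p13 ×-dec P? p24 ×-dec P? p14 ×-dec P? p23)

∃-Pair? : {P : Pair → Set} → (∀ σ → Dec (P σ)) → Dec (∃ P)
∃-Pair? P? = map′
  (λ { (inj₁ P₁₂) → p12 , P₁₂ ; (inj₂ (inj₁ P₃₄)) → p34 , P₃₄ ; (inj₂ (inj₂ (inj₁ P₁₃))) → p13 , P₁₃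
     ; (inj₂ (inj₂ (inj₂ (inj₁ P₂₄)))) → p24 , P₂₄ ; (inj₂ (inj₂ (inj₂ (inj₂ (inj₁ P₁₄))))) → p14 , P₁₄
     ; (inj₂ (inj₂ (inj₂ (inj₂ (inj₂ P₂₃))))) → p23 , P₂₃ })
  (λ { (p12 , P₁₂) → inj₁ P₁₂ ; (p34 , P₃₄) → inj₂ (inj₁ P₃₄) ; (p13 , P₁₃) → inj₂ (inj₂ (inj₁ P₁₃))
     ; (p24 , P₂₄) → inj₂ (inj₂ (inj₂ (inj₁ P₂₄))) ; (p14 , P₁₄) → inj₂ (inj₂ (inj₂ (inj₂ (inj₁ P₁₄))))
     ; (p23 , P₂₃) → inj₂ (inj₂ (inj₂ (inj₂ (inj₂ P₂₃)))) })
  (P? p12 ⊎-dec P? p34 ⊎-dec P? p13 ⊎-dec P? p24 ⊎-dec P? p14 ⊎-dec P? p23)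

vertex-HypVert : ∀ σ → HypVert (vertex σ)
vertex-HypVert σ = (λ i → fromBit-binary (i ∈ₚ σ)) , from-yes (∀-Pair? λ σ → sumF (vertex σ) ≟ 1ℚ + 1ℚ) σ

vertex-diagonals : (∀ i → vertex p12 i + vertex p34 i ≡ vertex p13 i + vertex p24 i) ×
                   (∀ i → vertex p12 i + vertex p34 i ≡ vertex p14 i + vertex p23 i)
vertex-diagonals = from-yes (all? (λ i → vertex p12 i + vertex p34 i ≟ vertex p13 i + vertex p24 i) ×-dec
                             all? (λ i → vertex p12 i + vertex p34 i ≟ vertex p14 i + vertex p23 i))

siblings-distinct : ∀ σ → ¬ (vertex (proj₁ (siblings σ)) ≋ vertex (proj₂ (siblings σ)))
siblings-distinct = from-yes (∀-Pair? λ σ → ¬? (all? λ i → vertex (proj₁ (siblings σ)) i ≟ vertex (proj₂ (siblings σ)) i))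

bits-with-two-ones : ∀ a₀ a₁ a₂ a₃ → fromBit a₀ + (fromBit a₁ + (fromBit a₂ + (fromBit a₃ + 0ℚ))) ≡ 1ℚ + 1ℚ →
                     ∃ λ σ → (a₀ ≡ 0F ∈ₚ σ) × (a₁ ≡ 1F ∈ₚ σ) × (a₂ ≡ 2F ∈ₚ σ) × (a₃ ≡ 3F ∈ₚ σ)
bits-with-two-ones = from-yes (
  ∀-Bool? λ a₀ → ∀-Bool? λ a₁ → ∀-Bool? λ a₂ → ∀-Bool? λ a₃ →
  (fromBit a₀ + (fromBit a₁ + (fromBit a₂ + (fromBit a₃ + 0ℚ))) ≟ 1ℚ + 1ℚ) →-dec
  ∃-Pair? λ σ → (a₀ ≟ᵇ 0F ∈ₚ σ) ×-dec (a₁ ≟ᵇ 1F ∈ₚ σ) ×-dec (a₂ ≟ᵇ 2F ∈ₚ σ) ×-dec (a₃ ≟ᵇ 3F ∈ₚ σ))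

HypVert⇒vertex : ∀ {x} → HypVert x → ∃ λ σ → x ≋ vertex σ
HypVert⇒vertex {x} (x∈01 , Σx≡2) = vertex-of-bits (bits-with-two-ones (a 0F) (a 1F) (a 2F) (a 3F) (trans (sym (sumF-cong x≡a)) Σx≡2))
  where
  a : Fin 4 → Bool
  a i = proj₁ (IsBin⇒fromBit (x∈01 i))
  x≡a : ∀ i → x i ≡ fromBit (a i)
  x≡a i = proj₂ (IsBin⇒fromBit (x∈01 i))
  vertex-of-bits : (∃ λ σ → (a 0F ≡ 0F ∈ₚ σ) × (a 1F ≡ 1F ∈ₚ σ) × (a 2F ≡ 2F ∈ₚ σ) × (a 3F ≡ 3F ∈ₚ σ)) →
                   ∃ λ σ → x ≋ vertex σ
  vertex-of-bits (σ , a₀≡ , a₁≡ , a₂≡ , a₃≡) = σ , λ where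
    0F → trans (x≡a 0F) (cong fromBit a₀≡)
    1F → trans (x≡a 1F) (cong fromBit a₁≡)
    2F → trans (x≡a 2F) (cong fromBit a₂≡)
    3F → trans (x≡a 3F) (cong fromBit a₃≡)

-- The possible sets {σ : (y σ)_j = 1} for one coordinate j of the images y σ of the vertices.
data Support : Set where
  empty full  : Support
  star costar : Fin 4 → Support

_∋_ : Support → Pair → Bool
empty    ∋ σ = false
full     ∋ σ = true
star i   ∋ σ = i ∈ₚ σ
costar i ∋ σ = not (i ∈ₚ σ)

starLike : Support → Bool
starLike empty      = false
starLike full       = true
starLike (star _)   = true
starLike (costar _) = false

costarLike : Support → Bool
costarLike empty      = false
costarLike full       = true
costarLike (star _)   = false
costarLike (costar _) = true

Disjoint : Support → Support → Set
Disjoint t u = ∀ σ → (t ∋ σ ∧ u ∋ σ) ≡ false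

∀-Support? : {P : Support → Set} → (∀ t → Dec (P t)) → Dec (∀ t → P t)
∀-Support? P? = map′
  (λ { (P∅ , Pfull , Pstar , Pcostar) → λ { empty → P∅ ; full → Pfull ; (star i) → Pstar i ; (costar i) → Pcostar i } })
  (λ ∀P → ∀P empty , ∀P full , (λ i → ∀P (star i)) , (λ i → ∀P (costar i)))
  (P? empty ×-dec P? full ×-dec all? (λ i → P? (star i)) ×-dec all? (λ i → P? (costar i)))

∃-Support? : {P : Support → Set} → (∀ t → Dec (P t)) → Dec (∃ P)
∃-Support? P? = map′
  (λ { (inj₁ P∅) → empty , P∅ ; (inj₂ (inj₁ Pfull)) → full , Pfull
     ; (inj₂ (inj₂ (inj₁ (i , Pstar)))) → star i , Pstar ; (inj₂ (inj₂ (inj₂ (i , Pcostar)))) → costar i , Pcostar })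
  (λ { (empty , P∅) → inj₁ P∅ ; (full , Pfull) → inj₂ (inj₁ Pfull)
     ; (star i , Pstar) → inj₂ (inj₂ (inj₁ (i , Pstar))) ; (costar i , Pcostar) → inj₂ (inj₂ (inj₂ (i , Pcostar))) })
  (P? empty ⊎-dec P? full ⊎-dec any? (λ i → P? (star i)) ⊎-dec any? (λ i → P? (costar i)))

Balanced : (Pair → ℚ) → Set
Balanced y = (y p12 + y p34 ≡ y p13 + y p24) × (y p12 + y p34 ≡ y p14 + y p23)

Balanced-resp : ∀ {y y′ : Pair → ℚ} → (∀ σ → y σ ≡ y′ σ) → Balanced y → Balanced y′
Balanced-resp y≡y′ (bal₁ , bal₂) =
  trans (sym (cong₂ _+_ (y≡y′ p12) (y≡y′ p34))) (trans bal₁ (cong₂ _+_ (y≡y′ p13) (y≡y′ p24))) ,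
  trans (sym (cong₂ _+_ (y≡y′ p12) (y≡y′ p34))) (trans bal₂ (cong₂ _+_ (y≡y′ p14) (y≡y′ p23)))

-- Opaque so that unfolding `support` below never re-runs this exhaustive check.
opaque
  balanced-bits-support :
    ∀ a₁₂ a₃₄ a₁₃ a₂₄ a₁₄ a₂₃ →
    fromBit a₁₂ + fromBit a₃₄ ≡ fromBit a₁₃ + fromBit a₂₄ → fromBit a₁₂ + fromBit a₃₄ ≡ fromBit a₁₄ + fromBit a₂₃ →
    ∃ λ t → (a₁₂ ≡ t ∋ p12) × (a₃₄ ≡ t ∋ p34) × (a₁₃ ≡ t ∋ p13) × (a₂₄ ≡ t ∋ p24) × (a₁₄ ≡ t ∋ p14) × (a₂₃ ≡ t ∋ p23)
  balanced-bits-support = from-yes (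
    ∀-Bool? λ a₁₂ → ∀-Bool? λ a₃₄ → ∀-Bool? λ a₁₃ → ∀-Bool? λ a₂₄ → ∀-Bool? λ a₁₄ → ∀-Bool? λ a₂₃ →
    (fromBit a₁₂ + fromBit a₃₄ ≟ fromBit a₁₃ + fromBit a₂₄) →-dec
    (fromBit a₁₂ + fromBit a₃₄ ≟ fromBit a₁₄ + fromBit a₂₃) →-dec
    ∃-Support? λ t → (a₁₂ ≟ᵇ t ∋ p12) ×-dec (a₃₄ ≟ᵇ t ∋ p34) ×-dec (a₁₃ ≟ᵇ t ∋ p13) ×-dec
                     (a₂₄ ≟ᵇ t ∋ p24) ×-dec (a₁₄ ≟ᵇ t ∋ p14) ×-dec (a₂₃ ≟ᵇ t ∋ p23))

column-support : (y : Pair → ℚ) → (∀ σ → IsBin (y σ)) → Balanced y → ∃ λ t → ∀ σ → y σ ≡ fromBit (t ∋ σ)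
column-support y y∈01 bal = support-of-bits (balanced-bits-support (a p12) (a p34) (a p13) (a p24) (a p14) (a p23) bal₁ bal₂)
  where
  a : Pair → Bool
  a σ = proj₁ (IsBin⇒fromBit (y∈01 σ))
  y≡a : ∀ σ → y σ ≡ fromBit (a σ)
  y≡a σ = proj₂ (IsBin⇒fromBit (y∈01 σ))
  bal₁ = proj₁ (Balanced-resp y≡a bal)
  bal₂ = proj₂ (Balanced-resp y≡a bal)
  support-of-bits :
    (∃ λ t → (a p12 ≡ t ∋ p12) × (a p34 ≡ t ∋ p34) × (a p13 ≡ t ∋ p13) × (a p24 ≡ t ∋ p24) × (a p14 ≡ t ∋ p14) × (a p23 ≡ t ∋ p23)) →
    ∃ λ t → ∀ σ → y σ ≡ fromBit (t ∋ σ)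
  support-of-bits (t , a₁₂≡ , a₃₄≡ , a₁₃≡ , a₂₄≡ , a₁₄≡ , a₂₃≡) = t , λ where
    p12 → trans (y≡a p12) (cong fromBit a₁₂≡)
    p34 → trans (y≡a p34) (cong fromBit a₃₄≡)
    p13 → trans (y≡a p13) (cong fromBit a₁₃≡)
    p24 → trans (y≡a p24) (cong fromBit a₂₄≡)
    p14 → trans (y≡a p14) (cong fromBit a₁₄≡)
    p23 → trans (y≡a p23) (cong fromBit a₂₃≡)

starLike+costarLike : ∀ t → fromBit (starLike t) + fromBit (costarLike t) ≡ fromBit (t ∋ p12) + fromBit (t ∋ p34)
starLike+costarLike = from-yes (∀-Support? λ t →
  fromBit (starLike t) + fromBit (costarLike t) ≟ fromBit (t ∋ p12) + fromBit (t ∋ p34))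

-- Two stars share the pair of their centres; two co-stars share the pair avoiding both centres.
starLike-intersecting : ∀ t u → Disjoint t u → (starLike t ∧ starLike u) ≡ false
starLike-intersecting = from-yes (∀-Support? λ t → ∀-Support? λ u →
  ∀-Pair? (λ σ → (t ∋ σ ∧ u ∋ σ) ≟ᵇ false) →-dec (starLike t ∧ starLike u ≟ᵇ false))

costarLike-intersecting : ∀ t u → Disjoint t u → (costarLike t ∧ costarLike u) ≡ false
costarLike-intersecting = from-yes (∀-Support? λ t → ∀-Support? λ u →
  ∀-Pair? (λ σ → (t ∋ σ ∧ u ∋ σ) ≟ᵇ false) →-dec (costarLike t ∧ costarLike u ≟ᵇ false))

starLike≡∋⇒siblings-agree : ∀ σ t → starLike t ≡ t ∋ σ → t ∋ proj₁ (siblings σ) ≡ t ∋ proj₂ (siblings σ)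
starLike≡∋⇒siblings-agree = from-yes (∀-Pair? λ σ → ∀-Support? λ t →
  (starLike t ≟ᵇ t ∋ σ) →-dec (t ∋ proj₁ (siblings σ) ≟ᵇ t ∋ proj₂ (siblings σ)))

-- An octahedral face of a stable set polytope

StableVec-resp : ∀ {k} (G : Graph k) {x x′ : Point k} → x ≋ x′ → StableVec G x → StableVec G x′
StableVec-resp G x≋x′ (x∈01 , x-stable) =
  (λ j → subst IsBin (x≋x′ j) (x∈01 j)) ,
  λ i l adj → subst₂ (λ p q → p + q ≤ 1ℚ) (x≋x′ i) (x≋x′ l) (x-stable i l adj)

module OctahedralFace
  {k} (G : Graph k) {c : Point k} {δ : ℚ} (valid : ValidIneq (SSP G) c δ)
  (A : Fin k → Fin 4 → ℚ) (b : Point k)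
  (injective : ∀ x y → Aff P x → Aff P y → affApp A b x ≋ affApp A b y → x ≋ y)
  (into : ∀ x → P x → Face (SSP G) c δ (affApp A b x))
  (onto : ∀ y → Face (SSP G) c δ y → Σ (Point 4) λ x → P x × affApp A b x ≋ y)
  where

  open AffineEquivalence {V = HypVert} {W = StableVec G} {c} {δ} (λ _ → proj₁) (λ _ → proj₁) valid A b injective into onto

  y : Pair → Point k
  y σ = f (vertex σ)

  vertex∈P : ∀ σ → P (vertex σ)
  vertex∈P σ = Conv-singleton {S = HypVert} (vertex-HypVert σ)

  vertex∈AffP : ∀ σ → Aff P (vertex σ)
  vertex∈AffP σ = Conv⇒Aff {S = P} (Conv-singleton {S = P} (vertex∈P σ))

  y-stable : ∀ σ → StableVec G (y σ)
  y-stable σ = image-stable (generator-image (vertex-HypVert σ))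
    where
    image-stable : (∃ λ s → StableVec G s × s ≋ y σ) → StableVec G (y σ)
    image-stable (s , s-stable , s≋yσ) = StableVec-resp G s≋yσ s-stable

  y-tight : ∀ σ → dot c (y σ) ≡ δ
  y-tight σ = proj₂ (into (vertex σ) (vertex∈P σ))

  column-balanced : ∀ j → Balanced (λ σ → y σ j)
  column-balanced j =
    affApp-parallelogram A b {vertex p12} {vertex p34} {vertex p13} {vertex p24} (proj₁ vertex-diagonals) j ,
    affApp-parallelogram A b {vertex p12} {vertex p34} {vertex p14} {vertex p23} (proj₂ vertex-diagonals) j

  support : Fin k → Support
  support j = proj₁ (column-support (λ σ → y σ j) (λ σ → proj₁ (y-stable σ) j) (column-balanced j))

  y≡support : ∀ σ j → y σ j ≡ fromBit (support j ∋ σ)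
  y≡support σ j = proj₂ (column-support (λ σ → y σ j) (λ σ → proj₁ (y-stable σ) j) (column-balanced j)) σ

  adjacent⇒disjoint : ∀ i l → Graph.Adj G i l → Disjoint (support i) (support l)
  adjacent⇒disjoint i l adj σ =
    fromBit-+≤1⇒disjoint (support i ∋ σ) (support l ∋ σ)
      (subst₂ (λ p q → p + q ≤ 1ℚ) (y≡support σ i) (y≡support σ l) (proj₂ (y-stable σ) i l adj))

  indicator-stable : (p : Support → Bool) → (∀ t u → Disjoint t u → (p t ∧ p u) ≡ false) →
                     StableVec G (λ j → fromBit (p (support j)))
  indicator-stable p p-intersecting =
    (λ j → fromBit-binary (p (support j))) ,
    λ i l adj → disjoint⇒fromBit-+≤1 (p (support i)) (p (support l))
                                       (p-intersecting (support i) (support l) (adjacent⇒disjoint i l adj))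

  z z̄ : Point k
  z j = fromBit (starLike (support j))
  z̄ j = fromBit (costarLike (support j))

  z-stable : StableVec G z
  z-stable = indicator-stable starLike starLike-intersecting

  z̄-stable : StableVec G z̄
  z̄-stable = indicator-stable costarLike costarLike-intersecting

  z-tight : dot c z ≡ δ
  z-tight = bounded-sum≡⇒≡ (valid z (Conv-singleton {S = StableVec G} z-stable))
                           (valid z̄ (Conv-singleton {S = StableVec G} z̄-stable)) (begin
    dot c z + dot c z̄               ≡⟨ sym (dot-+ c z z̄) ⟩
    dot c (λ j → z j + z̄ j)         ≡⟨ dot-cong c z+z̄ ⟩
    dot c (λ j → y p12 j + y p34 j) ≡⟨ dot-+ c (y p12) (y p34) ⟩
    dot c (y p12) + dot c (y p34)   ≡⟨ cong₂ _+_ (y-tight p12) (y-tight p34) ⟩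
    δ + δ                           ∎)
    where
    open ≡-Reasoning
    z+z̄ : ∀ j → z j + z̄ j ≡ y p12 j + y p34 j
    z+z̄ j = trans (starLike+costarLike (support j)) (sym (cong₂ _+_ (y≡support p12 j) (y≡support p34 j)))

  z-vertex-image : ∃ λ σ → y σ ≋ z
  z-vertex-image = vertex-image (binary-preimage (proj₁ z-stable) (Conv-singleton {S = StableVec G} z-stable , z-tight))
    where
    vertex-image : (∃ λ v → HypVert v × f v ≋ z) → ∃ λ σ → y σ ≋ z
    vertex-image (v , v-vertex , fv≋z) = σ , λ j → trans (affApp-cong A b (λ i → sym (v≋σ i)) j) (fv≋z j)
      where
      σ = proj₁ (HypVert⇒vertex v-vertex)
      v≋σ = proj₂ (HypVert⇒vertex v-vertex)

  siblings-collapse : ∀ σ → y σ ≋ z → y (proj₁ (siblings σ)) ≋ y (proj₂ (siblings σ))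
  siblings-collapse σ yσ≋z j = begin
    y τ₁ j                   ≡⟨ y≡support τ₁ j ⟩
    fromBit (support j ∋ τ₁) ≡⟨ cong fromBit (starLike≡∋⇒siblings-agree σ (support j) starLike≡∋σ) ⟩
    fromBit (support j ∋ τ₂) ≡⟨ sym (y≡support τ₂ j) ⟩
    y τ₂ j                   ∎
    where
    open ≡-Reasoning
    τ₁ = proj₁ (siblings σ)
    τ₂ = proj₂ (siblings σ)
    starLike≡∋σ : starLike (support j) ≡ support j ∋ σ
    starLike≡∋σ = fromBit-injective _ _ (trans (sym (yσ≋z j)) (y≡support σ j))

theorem6 : (k : ℕ) (G : Graph k) → ¬ (P ≤A SSP G)
theorem6 k G (c , δ , valid , A , b , _ , injective , _ , into , onto) =
  siblings-distinct σ (injective _ _ (vertex∈AffP τ₁) (vertex∈AffP τ₂) (siblings-collapse σ yσ≋z))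
  where
  open OctahedralFace G {c} {δ} valid A b injective into onto
  σ = proj₁ z-vertex-image
  yσ≋z = proj₂ z-vertex-image
  τ₁ = proj₁ (siblings σ)
  τ₂ = proj₂ (siblings σ)
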